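{- Let $G$ be a graph with $m$ edges and let $k$ be a positive integer. If $m<k$, then $G$ has no $2$-valid edge coloring using exactly $k$ colors. If $m\ge k$ and the maximum matching of $G$ has size at least $k-1$, then $G$ has a $2$-valid edge coloring using exactly $k$ colors.
   Context: All graphs are finite, simple and undirected. An edge coloring of $G=(V,E)$ with $k$ colors is a surjective map $c:E\to[k]$; it is $2$-valid if for every vertex $v$ the edges incident to $v$ receive at most $2$ distinct colors. -}

module Defs where

open import Data.Nat using (ℕ)
open import Data.Fin using (Fin)
open import Data.Product using (Σ; ∃; _×_; _,_)
open import Data.Sum using (_⊎_)
open import Relation.Binary.PropositionalEquality using (_≡_; _≢_)
open import Relation.Nullary using (¬_)

-- So m is exactly the number of edges.
record Graph : Set where
  field
    n      : ℕ
    m      : ℕ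
    src    : Fin m → Fin n
    tgt    : Fin m → Fin n
    loopless : ∀ e → src e ≢ tgt e
    simple : ∀ e e′ →
             ((src e ≡ src e′ × tgt e ≡ tgt e′) ⊎ (src e ≡ tgt e′ × tgt e ≡ src e′)) →
             e ≡ e′
open Graph public

Incident : (G : Graph) → Fin (n G) → Fin (m G) → Set
Incident G x e = src G e ≡ x ⊎ tgt G e ≡ x

-- edge coloring with k colors: surjective map E → [k]
Surj : ∀ {a b} → (Fin a → Fin b) → Set
Surj {a} {b} c = ∀ (y : Fin b) → ∃ λ (x : Fin a) → c x ≡ y

-- 2-valid: at every vertex the incident edges receive at most 2 distinct
-- colors, i.e. among any three incident edges two share a color.
TwoValid : (G : Graph) {k : ℕ} → (Fin (m G) → Fin k) → Set
TwoValid G c = ∀ (x : Fin (n G)) (e₁ e₂ e₃ : Fin (m G)) →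
  Incident G x e₁ → Incident G x e₂ → Incident G x e₃ →
  c e₁ ≡ c e₂ ⊎ c e₁ ≡ c e₃ ⊎ c e₂ ≡ c e₃

Has2ValidColoring : Graph → ℕ → Set
Has2ValidColoring G k = Σ (Fin (m G) → Fin k) λ c → Surj c × TwoValid G c

-- G has a matching of size s (s distinct, pairwise vertex-disjoint edges);
-- equivalently, the maximum matching of G has size at least s.
HasMatchingOfSize : Graph → ℕ → Set
HasMatchingOfSize G s = Σ (Fin s → Fin (m G)) λ f →
  ∀ i j → i ≢ j → ∀ x → Incident G x (f i) → ¬ Incident G x (f j)

-- Colour the i-th edge of a matching of size k − 1 with colour i and every
-- other edge with the last colour k.  Each vertex meets at most one matching
-- edge, so it sees at most two colours, and since k ≤ m some edge lies
-- outside the matching, so the last colour is used.  Conversely a surjection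
-- from m edges onto k colours forces k ≤ m.
module Submission where

open import Defs
open import Data.Nat using (ℕ; suc; _<_; _≤_; _∸_)
open import Data.Nat.Properties using (<⇒≱)
open import Data.Fin using (Fin; fromℕ; inject₁; _≟_)
open import Data.Fin.Properties using (any?; ¬∀⟶∃¬; injective⇒≤)
open import Data.Fin.Relation.Unary.Top using (view; ‵fromℕ; ‵inject₁)
open import Data.Product using (∃; _×_; _,_; proj₂)
open import Data.Sum using (_⊎_; inj₁; inj₂)
open import Data.Empty using (⊥-elim)
open import Function.Definitions using (Injective)
open import Relation.Nullary using (¬_; yes; no)
open import Relation.Unary using (Decidable)
open import Relation.Binary.PropositionalEquality using (_≡_; _≢_; refl; sym; trans; cong)

surjective⇒≤ : ∀ {a b} {c : Fin a → Fin b} → Surj c → b ≤ a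
surjective⇒≤ {c = c} surj = injective⇒≤ λ {y} {y′} eq →
  trans (sym (proj₂ (surj y))) (trans (cong c eq) (proj₂ (surj y′)))

module _ {k m : ℕ} (f : Fin k → Fin m) where

  InImage : Fin m → Set
  InImage e = ∃ λ i → f i ≡ e

  inImage? : Decidable InImage
  inImage? e = any? λ i → f i ≟ e

  ∃-∉-image : k < m → ∃ λ e → ¬ InImage e
  ∃-∉-image k<m = ¬∀⟶∃¬ m InImage inImage? λ surj → <⇒≱ k<m (surjective⇒≤ surj)

  indexColouring : Fin m → Fin (suc k)
  indexColouring e with inImage? e
  ... | yes (i , _) = inject₁ i
  ... | no _        = fromℕ k

  indexColouring-image : Injective _≡_ _≡_ f → ∀ i → indexColouring (f i) ≡ inject₁ i
  indexColouring-image f-inj i with inImage? (f i)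
  ... | yes (j , fj≡fi) = cong inject₁ (f-inj fj≡fi)
  ... | no ∉image       = ⊥-elim (∉image (i , refl))

  indexColouring-∉-image : ∀ {e} → ¬ InImage e → indexColouring e ≡ fromℕ k
  indexColouring-∉-image {e} ∉image with inImage? e
  ... | yes ∈image = ⊥-elim (∉image ∈image)
  ... | no _       = refl

  indexColouring-last-or-image : ∀ e → indexColouring e ≡ fromℕ k ⊎ InImage e
  indexColouring-last-or-image e with inImage? e
  ... | yes ∈image = inj₂ ∈image
  ... | no _       = inj₁ refl

  indexColouring-surjective : Injective _≡_ _≡_ f → k < m → Surj indexColouring
  indexColouring-surjective f-inj k<m y with view y
  ... | ‵fromℕ     = let e , ∉image = ∃-∉-image k<m in e , indexColouring-∉-image ∉image
  ... | ‵inject₁ i = f i , indexColouring-image f-inj i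

constant-off-matching⇒TwoValid :
  ∀ (G : Graph) {k} (c : Fin (m G) → Fin k) (z : Fin k) (M : Fin (m G) → Set) →
  (∀ e → c e ≡ z ⊎ M e) →
  (∀ {x e e′} → Incident G x e → Incident G x e′ → M e → M e′ → e ≡ e′) →
  TwoValid G c
constant-off-matching⇒TwoValid G c z M z-or-M unique x e₁ e₂ e₃ a₁ a₂ a₃
  with z-or-M e₁ | z-or-M e₂ | z-or-M e₃
... | inj₁ z₁ | inj₁ z₂ | _       = inj₁ (trans z₁ (sym z₂))
... | inj₁ z₁ | inj₂ _  | inj₁ z₃ = inj₂ (inj₁ (trans z₁ (sym z₃)))
... | inj₂ _  | inj₁ z₂ | inj₁ z₃ = inj₂ (inj₂ (trans z₂ (sym z₃)))
... | inj₂ m₁ | inj₂ m₂ | _       = inj₁ (cong c (unique a₁ a₂ m₁ m₂))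
... | inj₂ m₁ | inj₁ _  | inj₂ m₃ = inj₂ (inj₁ (cong c (unique a₁ a₃ m₁ m₃)))
... | inj₁ _  | inj₂ m₂ | inj₂ m₃ = inj₂ (inj₂ (cong c (unique a₂ a₃ m₂ m₃)))

module _ (G : Graph) {s : ℕ} (f : Fin s → Fin (m G))
         (disjoint : ∀ i j → i ≢ j → ∀ x → Incident G x (f i) → ¬ Incident G x (f j)) where

  matching-shared-vertex : ∀ {x i j} → Incident G x (f i) → Incident G x (f j) → i ≡ j
  matching-shared-vertex {x} {i} {j} a b with i ≟ j
  ... | yes i≡j = i≡j
  ... | no i≢j  = ⊥-elim (disjoint i j i≢j x a b)

  matching-injective : Injective _≡_ _≡_ f
  matching-injective fi≡fj = matching-shared-vertex (inj₁ refl) (inj₁ (cong (src G) (sym fi≡fj)))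

  matching-edges-at-vertex-≡ : ∀ {x e e′} → Incident G x e → Incident G x e′ →
                               InImage f e → InImage f e′ → e ≡ e′
  matching-edges-at-vertex-≡ a a′ (i , refl) (j , refl) = cong f (matching-shared-vertex a a′)

fewer-edges⇒¬Has2ValidColoring : ∀ G {k} → m G < k → ¬ Has2ValidColoring G k
fewer-edges⇒¬Has2ValidColoring G m<k (_ , surj , _) = <⇒≱ m<k (surjective⇒≤ surj)

matching⇒Has2ValidColoring : ∀ G {k} → k < m G → HasMatchingOfSize G k → Has2ValidColoring G (suc k)
matching⇒Has2ValidColoring G {k} k<m (f , disjoint) =
  indexColouring f ,
  indexColouring-surjective f (matching-injective G f disjoint) k<m ,
  constant-off-matching⇒TwoValid G (indexColouring f) (fromℕ k) (InImage f)
    (indexColouring-last-or-image f) (matching-edges-at-vertex-≡ G f disjoint)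

mainTheorem6 : (G : Graph) (k : ℕ) → 1 ≤ k →
    (m G < k → ¬ Has2ValidColoring G k) ×
    (k ≤ m G → HasMatchingOfSize G (k ∸ 1) → Has2ValidColoring G k)
mainTheorem6 G (suc k) _ = fewer-edges⇒¬Has2ValidColoring G , matching⇒Has2ValidColoring G
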